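{- Let $\mathcal{A}=\{a_k\}_{k\in\mathbb{N}}$ and $\{c_k\}_{k\in\mathbb{N}}$ be two sequences of positive integers, and for $k\in\mathbb{N}$ let $\mathcal{B}_k:=\{a_k+(s-1)c_k: s\in\mathbb{N}\}$. If $\sum_{k=1}^\infty c_k^{ -1}$ converges and the set $\mathcal{A}$ has asymptotic density zero, then $\bigcup_{k=1}^\infty\mathcal{B}_k$ has an asymptotic density.
   Context: $\mathbb{N}=\{1,2,3,\dots\}$. The asymptotic density of $A\subseteq\mathbb{N}$ is $\lim_{N\to\infty}\frac{\#(A\cap[1,N])}{N}$ when this limit exists. -}

module Defs where

open import Data.Nat as ℕ using (ℕ; zero; suc; _≤_)
open import Data.Integer using (+_)
open import Data.Rational as ℚ using (ℚ; 0ℚ; _-_; ∣_∣; _/_)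
import Data.Rational as Q
open import Data.Product using (Σ; ∃; ∃-syntax; _×_)
open import Relation.Nullary using (Dec; yes; no)
open import Relation.Binary.PropositionalEquality using (_≡_)

-- Classical excluded middle (as a hypothesis): needed because membership in an
-- infinite union of progressions is not decidable constructively.
LEM : Set₁
LEM = (P : Set) → Dec P

count : LEM → (ℕ → Set) → ℕ → ℕ
count lem P zero = zero
count lem P (suc N) with lem (P (suc N))
... | yes _ = suc (count lem P N)
... | no  _ = count lem P N

-- #(P ∩ [1,N]) / N, indexed by N-1 (so N ≥ 1)
ratio : LEM → (ℕ → Set) → ℕ → ℚ
ratio lem P N = (+ count lem P (suc N)) / suc N

-- the asymptotic density exists: the sequence of ratios is Cauchy
-- (equivalently, converges in ℝ)
HasDensity : LEM → (ℕ → Set) → Set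
HasDensity lem P =
  (ε : ℚ) → Q.0ℚ Q.< ε → ∃[ M ] ((m n : ℕ) → M ≤ m → M ≤ n →
    ∣ ratio lem P m - ratio lem P n ∣ Q.< ε)

HasDensityZero : LEM → (ℕ → Set) → Set
HasDensityZero lem P =
  (ε : ℚ) → Q.0ℚ Q.< ε → ∃[ M ] ((n : ℕ) → M ≤ n → ratio lem P n Q.< ε)

-- 1/n as a rational (value at 0 is irrelevant: only used for positive n)
inv : ℕ → ℚ
inv zero = 0ℚ
inv (suc n) = (+ 1) / suc n

partialSum : (ℕ → ℕ) → ℕ → ℚ
partialSum c zero = 0ℚ
partialSum c (suc n) = partialSum c n Q.+ inv (c n)

SeriesConverges : (ℕ → ℕ) → Set
SeriesConverges c =
  (ε : ℚ) → Q.0ℚ Q.< ε → ∃[ M ] ((m n : ℕ) → M ≤ m → M ≤ n →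
    ∣ partialSum c m - partialSum c n ∣ Q.< ε)

RangeSet : (ℕ → ℕ) → ℕ → Set
RangeSet a n = ∃[ k ] (a k ≡ n)

-- ℬ_k = {a_k + (s-1) c_k : s ∈ ℕ} = {a_k + t c_k : t ≥ 0}
Prog : (ℕ → ℕ) → (ℕ → ℕ) → ℕ → ℕ → Set
Prog a c k n = ∃[ t ] (n ≡ a k ℕ.+ t ℕ.* c k)

UnionProg : (ℕ → ℕ) → (ℕ → ℕ) → ℕ → Set
UnionProg a c n = ∃[ k ] Prog a c k n

-- Fix K.  Beyond ∑_{k<K} a_k the union of the first K progressions is periodic with period
-- ∏_{k<K} c_k, so its counting function is linear up to a bounded error.  Any other element
-- n ≤ N of the union is either some a_k, or a_k + t c_k with t ≥ 1 and k ≥ K, which forces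
-- c_k ≤ N; the progression ℬ_k contains at most N / c_k such terms.  Since 𝒜 has density zero
-- and ∑_{k ≥ K} 1/c_k is small for K large, this remainder is an arbitrarily small fraction
-- of [1,N], and so the ratios of the union form a Cauchy sequence.
module Submission where

open import Defs
open import Data.Nat using (ℕ; _<_)
open import Data.Nat using (_≤_; _+_; NonZero)

open import Data.Empty using (⊥-elim)
open import Data.Product using (∃₂; ∃-syntax; _×_; _,_; proj₁; proj₂)
open import Data.Sum using (_⊎_; inj₁; inj₂)
open import Function.Bundles using (_⇔_; mk⇔; Equivalence)
open import Relation.Nullary using (¬_; yes; no)
open import Relation.Binary.PropositionalEquality
  using (_≡_; refl; sym; trans; cong; cong₂; subst; subst₂; module ≡-Reasoning)
import Data.Rational.Properties as ℚ

module BigOperators where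

  open import Data.Nat
  open import Data.Nat.Properties
  open import Data.Nat.Divisibility using (_∣_; ∣-refl; ∣m⇒∣m*n; ∣n⇒∣m*n)

  ∑< : ℕ → (ℕ → ℕ) → ℕ
  ∑< zero    f = 0
  ∑< (suc m) f = ∑< m f + f m

  ∏< : ℕ → (ℕ → ℕ) → ℕ
  ∏< zero    f = 1
  ∏< (suc m) f = ∏< m f * f m

  syntax ∑< m (λ i → e) = ∑[ i < m ] e
  syntax ∏< m (λ i → e) = ∏[ i < m ] e

  term≤∑< : ∀ f {m k} → k < m → f k ≤ ∑< m f
  term≤∑< f {suc m} k<1+m with m≤n⇒m<n∨m≡n (≤-pred k<1+m)
  ... | inj₁ k<m  = ≤-trans (term≤∑< f k<m) (m≤m+n (∑< m f) (f m))
  ... | inj₂ refl = m≤n+m (f m) (∑< m f)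

  term∣∏< : ∀ f {m k} → k < m → f k ∣ ∏< m f
  term∣∏< f {suc m} k<1+m with m≤n⇒m<n∨m≡n (≤-pred k<1+m)
  ... | inj₁ k<m  = ∣m⇒∣m*n (f m) (term∣∏< f k<m)
  ... | inj₂ refl = ∣n⇒∣m*n (∏< m f) ∣-refl

  ∏<-pos : ∀ {f} → (∀ k → 0 < f k) → ∀ m → 0 < ∏< m f
  ∏<-pos f>0 zero    = s≤s z≤n
  ∏<-pos f>0 (suc m) = *-mono-< (∏<-pos f>0 m) (f>0 m)

open BigOperators

module Counting (lem : LEM) where

  open import Data.Nat
  open import Data.Nat.Properties
  open import Data.Nat.Induction using (<-rec)
  open import Algebra.Properties.CommutativeSemigroup +-commutativeSemigroup using (interchange)

  indicator : Set → ℕ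
  indicator X with lem X
  ... | yes _ = 1
  ... | no  _ = 0

  indicator-yes : ∀ {X} → X → indicator X ≡ 1
  indicator-yes {X} x with lem X
  ... | yes _ = refl
  ... | no ¬x = ⊥-elim (¬x x)

  indicator-no : ∀ {X} → ¬ X → indicator X ≡ 0
  indicator-no {X} ¬x with lem X
  ... | yes x = ⊥-elim (¬x x)
  ... | no  _ = refl

  indicator-≤1 : ∀ X → indicator X ≤ 1
  indicator-≤1 X with lem X
  ... | yes _ = ≤-refl
  ... | no  _ = z≤n

  indicator-cong : ∀ {X Y} → X ⇔ Y → indicator X ≡ indicator Y
  indicator-cong {X} {Y} X⇔Y with lem Y
  ... | yes y = indicator-yes (Equivalence.from X⇔Y y)
  ... | no ¬y = indicator-no (λ x → ¬y (Equivalence.to X⇔Y x))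

  indicator-⊎ : ∀ {X Y Z} → (X → Y ⊎ Z) → indicator X ≤ indicator Y + indicator Z
  indicator-⊎ {X} {Y} {Z} split with lem X
  ... | no _ = z≤n
  ... | yes x with split x
  ...   | inj₁ y rewrite indicator-yes y = s≤s z≤n
  ...   | inj₂ z rewrite indicator-yes z = m≤n+m 1 (indicator Y)

  indicator-complement : ∀ {X Y} → (Y → X) → indicator X ≡ indicator Y + indicator (X × ¬ Y)
  indicator-complement {X} {Y} Y⇒X with lem Y
  ... | yes y = trans (indicator-yes (Y⇒X y)) (sym (cong (1 +_) (indicator-no (λ (_ , ¬y) → ¬y y))))
  ... | no ¬y with lem X
  ...   | yes x = sym (indicator-yes (x , ¬y))
  ...   | no ¬x = sym (indicator-no (λ (x , _) → ¬x x))

  count-suc : ∀ P N → count lem P (suc N) ≡ indicator (P (suc N)) + count lem P N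
  count-suc P N with lem (P (suc N))
  ... | yes _ = refl
  ... | no  _ = refl

  count-≤ : ∀ P N → count lem P N ≤ N
  count-≤ P zero    = z≤n
  count-≤ P (suc N) rewrite count-suc P N = +-mono-≤ (indicator-≤1 _) (count-≤ P N)

  count-∅ : ∀ {P} → (∀ n → ¬ P n) → ∀ N → count lem P N ≡ 0
  count-∅ ∅ zero    = refl
  count-∅ {P} ∅ (suc N) rewrite count-suc P N | indicator-no (∅ (suc N)) = count-∅ ∅ N

  count-mono : ∀ P m d → count lem P m ≤ count lem P (m + d)
  count-mono P m zero    = ≤-reflexive (cong (count lem P) (sym (+-identityʳ m)))
  count-mono P m (suc d) rewrite +-suc m d | count-suc P (m + d) =
    ≤-trans (count-mono P m d) (m≤n+m _ (indicator _))

  count-+ : ∀ P m d → count lem P (m + d) ≤ count lem P m + d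
  count-+ P m zero    = ≤-reflexive (trans (cong (count lem P) (+-identityʳ m)) (sym (+-identityʳ _)))
  count-+ P m (suc d) rewrite +-suc m d | count-suc P (m + d) | +-suc (count lem P m) d =
    +-mono-≤ (indicator-≤1 _) (count-+ P m d)

  count-⊎ : ∀ {P Q R} N → (∀ n → n ≤ N → P n → Q n ⊎ R n) →
            count lem P N ≤ count lem Q N + count lem R N
  count-⊎ zero split = z≤n
  count-⊎ {P} {Q} {R} (suc N) split rewrite count-suc P N | count-suc Q N | count-suc R N =
    begin
      indicator (P (suc N)) + count lem P N
        ≤⟨ +-mono-≤ (indicator-⊎ (split (suc N) ≤-refl))
                    (count-⊎ N (λ n n≤N → split n (m≤n⇒m≤1+n n≤N))) ⟩
      (indicator (Q (suc N)) + indicator (R (suc N))) + (count lem Q N + count lem R N)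
        ≡⟨ interchange (indicator (Q (suc N))) _ _ _ ⟩
      (indicator (Q (suc N)) + count lem Q N) + (indicator (R (suc N)) + count lem R N) ∎
    where open ≤-Reasoning

  count-complement : ∀ {P Q} → (∀ n → Q n → P n) → ∀ N →
                     count lem P N ≡ count lem Q N + count lem (λ n → P n × ¬ Q n) N
  count-complement Q⇒P zero = refl
  count-complement {P} {Q} Q⇒P (suc N)
    rewrite count-suc P N | count-suc Q N | count-suc (λ n → P n × ¬ Q n) N =
    begin
      indicator (P (suc N)) + count lem P N
        ≡⟨ cong₂ _+_ (indicator-complement (Q⇒P (suc N))) (count-complement Q⇒P N) ⟩
      (indicator (Q (suc N)) + indicator (P (suc N) × ¬ Q (suc N))) + (count lem Q N + count lem _ N)
        ≡⟨ interchange (indicator (Q (suc N))) _ _ _ ⟩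
      (indicator (Q (suc N)) + count lem Q N) + (indicator (P (suc N) × ¬ Q (suc N)) + count lem _ N) ∎
    where open ≡-Reasoning

  count-gap : ∀ {P} m d → (∀ n → m < n → n ≤ m + d → ¬ P n) → count lem P (m + d) ≡ count lem P m
  count-gap m zero    gap rewrite +-identityʳ m = refl
  count-gap {P} m (suc d) gap rewrite +-suc m d | count-suc P (m + d)
    | indicator-no (gap (suc (m + d)) (s≤s (m≤m+n m d)) ≤-refl) =
    count-gap m d (λ n m<n n≤m+d → gap n m<n (m≤n⇒m≤1+n n≤m+d))

  count-spaced : ∀ {P} c → (∀ n → P n → c ≤ n) → (∀ {m n} → P m → P n → m < n → m + c ≤ n) →
                 ∀ N → count lem P N * c ≤ N
  count-spaced {P} zero _ _ N rewrite *-zeroʳ (count lem P N) = z≤n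
  count-spaced {P} c@(suc c-1) large spaced = <-rec (λ N → count lem P N * c ≤ N) step
    where
    step : ∀ N → (∀ {m} → m < N → count lem P m * c ≤ m) → count lem P N * c ≤ N
    step zero    _  = z≤n
    step (suc N) ih with lem (P (suc N))
    ... | no _  = m≤n⇒m≤1+n (ih ≤-refl)
    ... | yes p = begin
      c + count lem P N * c     ≡⟨ cong (λ k → c + count lem P k * c) (sym m+c-1≡N) ⟩
      c + count lem P (m + c-1) * c ≡⟨ cong (λ k → c + k * c) (count-gap m c-1 gap) ⟩
      c + count lem P m * c     ≤⟨ +-monoʳ-≤ c (ih (s≤s (m∸n≤m N c-1))) ⟩
      c + m                     ≡⟨ cong suc (trans (+-comm c-1 m) m+c-1≡N) ⟩
      suc N                     ∎
      where
      open ≤-Reasoning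
      m = N ∸ c-1
      m+c-1≡N : m + c-1 ≡ N
      m+c-1≡N = m∸n+n≡m (≤-pred (large (suc N) p))
      gap : ∀ n → m < n → n ≤ m + c-1 → ¬ P n
      gap n m<n n≤m+c-1 pn = <⇒≱ m<n (+-cancelʳ-≤ c-1 n m (≤-pred (begin
        suc (n + c-1)   ≡⟨ sym (+-suc n c-1) ⟩
        n + c           ≤⟨ spaced pn p (s≤s (subst (n ≤_) m+c-1≡N n≤m+c-1)) ⟩
        suc N           ≡⟨ cong suc (sym m+c-1≡N) ⟩
        suc (m + c-1)   ∎)))

  count-∃< : ∀ {Q : ℕ → ℕ → Set} m N →
             count lem (λ n → ∃[ i ] (i < m × Q i n)) N ≤ ∑[ i < m ] count lem (Q i) N
  count-∃< zero N = ≤-reflexive (count-∅ (λ { n (_ , () , _) }) N)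
  count-∃< {Q} (suc m) N =
    ≤-trans (count-⊎ N last-or-earlier) (+-monoˡ-≤ (count lem (Q m) N) (count-∃< m N))
    where
    last-or-earlier : ∀ n → n ≤ N → ∃[ i ] (i < suc m × Q i n) → ∃[ i ] (i < m × Q i n) ⊎ Q m n
    last-or-earlier n _ (i , i<1+m , q) with m≤n⇒m<n∨m≡n (≤-pred i<1+m)
    ... | inj₁ i<m  = inj₁ (i , i<m , q)
    ... | inj₂ refl = inj₂ q

  Progression⁺ : ℕ → ℕ → ℕ → Set
  Progression⁺ a c n = ∃[ t ] (n ≡ a + suc t * c)

  count-Progression⁺ : ∀ a c N → count lem (Progression⁺ a c) N * c ≤ N
  count-Progression⁺ a c = count-spaced c large spaced
    where
    large : ∀ n → Progression⁺ a c n → c ≤ n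
    large n (t , refl) = ≤-trans (m≤m+n c (t * c)) (m≤n+m _ a)
    spaced : ∀ {m n} → Progression⁺ a c m → Progression⁺ a c n → m < n → m + c ≤ n
    spaced (t , refl) (u , refl) m<n = begin
      a + suc t * c + c     ≡⟨ +-assoc a (suc t * c) c ⟩
      a + (suc t * c + c)   ≡⟨ cong (a +_) (+-comm (suc t * c) c) ⟩
      a + suc (suc t) * c   ≤⟨ +-monoʳ-≤ a (*-monoˡ-≤ c (*-cancelʳ-< c (suc t) (suc u) (+-cancelˡ-< a _ _ m<n))) ⟩
      a + suc u * c         ∎
      where open ≤-Reasoning

module EventuallyPeriodicCount (lem : LEM) (P : ℕ → Set) (n₀ L : ℕ) {{_ : NonZero L}}
  (periodic : ∀ n → n₀ ≤ n → P n ⇔ P (n + L)) where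

  open import Data.Nat
  open import Data.Nat.Properties
  open import Data.Nat.DivMod using (_/_; _%_; m≡m%n+[m/n]*n; m%n<n)
  open import Data.Nat.Tactic.RingSolver using (solve-∀)
  open Counting lem

  perPeriod : ℕ
  perPeriod = count lem P (n₀ + L) ∸ count lem P n₀

  perPeriod≤L : perPeriod ≤ L
  perPeriod≤L = begin
    count lem P (n₀ + L) ∸ count lem P n₀        ≤⟨ ∸-monoˡ-≤ (count lem P n₀) (count-+ P n₀ L) ⟩
    count lem P n₀ + L ∸ count lem P n₀          ≡⟨ m+n∸m≡n (count lem P n₀) L ⟩
    L                                             ∎
    where open ≤-Reasoning

  count-shift : ∀ j → count lem P (n₀ + j + L) ≡ count lem P (n₀ + j) + perPeriod
  count-shift zero rewrite +-identityʳ n₀ = sym (m+[n∸m]≡n (count-mono P n₀ L))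
  count-shift (suc j) = begin
    count lem P (n₀ + suc j + L)                          ≡⟨ cong (λ n → count lem P (n + L)) (+-suc n₀ j) ⟩
    count lem P (suc (n₀ + j + L))                        ≡⟨ count-suc P (n₀ + j + L) ⟩
    indicator (P (suc (n₀ + j) + L)) + count lem P (n₀ + j + L)
      ≡⟨ cong₂ _+_ (sym (indicator-cong (periodic (suc (n₀ + j)) (m≤n⇒m≤1+n (m≤m+n n₀ j))))) (count-shift j) ⟩
    indicator (P (suc (n₀ + j))) + (count lem P (n₀ + j) + perPeriod)
      ≡⟨ sym (+-assoc (indicator _) (count lem P (n₀ + j)) perPeriod) ⟩
    (indicator (P (suc (n₀ + j))) + count lem P (n₀ + j)) + perPeriod
      ≡⟨ cong (_+ perPeriod) (sym (count-suc P (n₀ + j))) ⟩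
    count lem P (suc (n₀ + j)) + perPeriod                ≡⟨ cong (λ n → count lem P n + perPeriod) (sym (+-suc n₀ j)) ⟩
    count lem P (n₀ + suc j) + perPeriod                  ∎
    where open ≡-Reasoning

  count-periods : ∀ q r → count lem P (n₀ + r + q * L) ≡ count lem P (n₀ + r) + q * perPeriod
  count-periods zero r = trans (cong (count lem P) (+-identityʳ (n₀ + r))) (sym (+-identityʳ _))
  count-periods (suc q) r = begin
    count lem P (n₀ + r + (L + q * L))          ≡⟨ cong (count lem P) (regroup n₀ r L (q * L)) ⟩
    count lem P (n₀ + (r + q * L) + L)          ≡⟨ count-shift (r + q * L) ⟩
    count lem P (n₀ + (r + q * L)) + perPeriod  ≡⟨ cong (λ n → count lem P n + perPeriod) (sym (+-assoc n₀ r (q * L))) ⟩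
    count lem P (n₀ + r + q * L) + perPeriod    ≡⟨ cong (_+ perPeriod) (count-periods q r) ⟩
    count lem P (n₀ + r) + q * perPeriod + perPeriod
      ≡⟨ trans (+-assoc (count lem P (n₀ + r)) _ _) (cong (count lem P (n₀ + r) +_) (+-comm (q * perPeriod) perPeriod)) ⟩
    count lem P (n₀ + r) + suc q * perPeriod    ∎
    where
    open ≡-Reasoning
    regroup : ∀ n r l m → n + r + (l + m) ≡ n + (r + m) + l
    regroup = solve-∀

  period-decomposition : ∀ N → n₀ ≤ N → ∃₂ λ q r → r < L × N ≡ n₀ + r + q * L
  period-decomposition N n₀≤N = j / L , j % L , m%n<n j L , (begin
    N                           ≡⟨ sym (m+[n∸m]≡n n₀≤N) ⟩
    n₀ + j                      ≡⟨ cong (n₀ +_) (m≡m%n+[m/n]*n j L) ⟩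
    n₀ + (j % L + j / L * L)    ≡⟨ sym (+-assoc n₀ (j % L) _) ⟩
    n₀ + j % L + j / L * L      ∎)
    where
    open ≡-Reasoning
    j = N ∸ n₀

  L*count-periods : ∀ q r →
    L * count lem P (n₀ + r + q * L) ≡ L * count lem P (n₀ + r) + perPeriod * (q * L)
  L*count-periods q r =
    trans (cong (L *_) (count-periods q r)) (rearrange L (count lem P (n₀ + r)) q perPeriod)
    where
    rearrange : ∀ L x q p → L * (x + q * p) ≡ L * x + p * (q * L)
    rearrange = solve-∀

  slack : ℕ
  slack = L * (n₀ + L)

  count-upper : ∀ N → L * count lem P N ≤ perPeriod * N + slack
  count-upper N with N ≤? n₀
  ... | yes N≤n₀ = begin
    L * count lem P N     ≤⟨ *-monoʳ-≤ L (≤-trans (count-≤ P N) (≤-trans N≤n₀ (m≤m+n n₀ L))) ⟩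
    slack                 ≤⟨ m≤n+m slack (perPeriod * N) ⟩
    perPeriod * N + slack ∎
    where open ≤-Reasoning
  ... | no N≰n₀ with period-decomposition N (<⇒≤ (≰⇒> N≰n₀))
  ...   | q , r , r<L , refl = begin
    L * count lem P (n₀ + r + q * L)
      ≡⟨ L*count-periods q r ⟩
    L * count lem P (n₀ + r) + perPeriod * (q * L)
      ≤⟨ +-monoˡ-≤ _ (*-monoʳ-≤ L (≤-trans (count-≤ P (n₀ + r)) (+-monoʳ-≤ n₀ (<⇒≤ r<L)))) ⟩
    slack + perPeriod * (q * L)
      ≤⟨ +-monoˡ-≤ _ (m≤n+m slack (perPeriod * (n₀ + r))) ⟩
    perPeriod * (n₀ + r) + slack + perPeriod * (q * L)
      ≡⟨ split-p perPeriod (n₀ + r) slack (q * L) ⟩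
    perPeriod * (n₀ + r + q * L) + slack ∎
    where
    open ≤-Reasoning
    split-p : ∀ p n s m → p * n + s + p * m ≡ p * (n + m) + s
    split-p = solve-∀

  count-lower : ∀ N → perPeriod * N ≤ L * count lem P N + slack
  count-lower N with N ≤? n₀
  ... | yes N≤n₀ = begin
    perPeriod * N             ≤⟨ *-monoˡ-≤ N perPeriod≤L ⟩
    L * N                     ≤⟨ *-monoʳ-≤ L (≤-trans N≤n₀ (m≤m+n n₀ L)) ⟩
    slack                     ≤⟨ m≤n+m slack (L * count lem P N) ⟩
    L * count lem P N + slack ∎
    where open ≤-Reasoning
  ... | no N≰n₀ with period-decomposition N (<⇒≤ (≰⇒> N≰n₀))
  ...   | q , r , r<L , refl = begin
    perPeriod * (n₀ + r + q * L)
      ≡⟨ *-distribˡ-+ perPeriod (n₀ + r) (q * L) ⟩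
    perPeriod * (n₀ + r) + perPeriod * (q * L)
      ≤⟨ +-monoˡ-≤ _ (≤-trans (*-monoˡ-≤ (n₀ + r) perPeriod≤L) (*-monoʳ-≤ L (+-monoʳ-≤ n₀ (<⇒≤ r<L)))) ⟩
    slack + perPeriod * (q * L)
      ≤⟨ +-monoʳ-≤ slack (m≤n+m _ (L * count lem P (n₀ + r))) ⟩
    slack + (L * count lem P (n₀ + r) + perPeriod * (q * L))
      ≡⟨ cong (slack +_) (sym (L*count-periods q r)) ⟩
    slack + L * count lem P (n₀ + r + q * L)
      ≡⟨ +-comm slack _ ⟩
    L * count lem P (n₀ + r + q * L) + slack ∎
    where open ≤-Reasoning

  -- |count P M / M − count P N / N| ≤ slack (1/M + 1/N) / L, multiplied out.
  count-cross : ∀ M N → L * count lem P M * N ≤ L * count lem P N * M + slack * (M + N)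
  count-cross M N = begin
    L * count lem P M * N                        ≤⟨ *-monoˡ-≤ N (count-upper M) ⟩
    (perPeriod * M + slack) * N                  ≡⟨ swap perPeriod M slack N ⟩
    perPeriod * N * M + slack * N                ≤⟨ +-monoˡ-≤ (slack * N) (*-monoˡ-≤ M (count-lower N)) ⟩
    (L * count lem P N + slack) * M + slack * N  ≡⟨ collect (L * count lem P N) slack M N ⟩
    L * count lem P N * M + slack * (M + N)      ∎
    where
    open ≤-Reasoning
    swap : ∀ p m s n → (p * m + s) * n ≡ p * n * m + s * n
    swap = solve-∀
    collect : ∀ x s m n → (x + s) * m + s * n ≡ x * m + s * (m + n)
    collect = solve-∀

module UnionOfProgressions (lem : LEM) (a c : ℕ → ℕ) (c>0 : ∀ k → 0 < c k) where

  open import Data.Nat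
  open import Data.Nat.Properties
  open import Data.Nat.Divisibility using (_∣_; divides)
  open import Data.Nat.Tactic.RingSolver using (solve-∀)
  open Counting lem

  Prog-periodic : ∀ {k L n} → c k ∣ L → a k ≤ n → Prog a c k n ⇔ Prog a c k (n + L)
  Prog-periodic {k} {L} {n} (divides q refl) a≤n = mk⇔ forward backward
    where
    instance _ = >-nonZero (c>0 k)
    forward : Prog a c k n → Prog a c k (n + q * c k)
    forward (t , refl) = t + q , shift (a k) t q (c k)
      where
      shift : ∀ a t q c → a + t * c + q * c ≡ a + (t + q) * c
      shift = solve-∀
    backward : Prog a c k (n + q * c k) → Prog a c k n
    backward (t , eq) = t ∸ q , +-cancelʳ-≡ (q * c k) n _ (begin
      n + q * c k                   ≡⟨ eq ⟩
      a k + t * c k                 ≡⟨ cong (λ s → a k + s * c k) (sym (m∸n+n≡m q≤t)) ⟩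
      a k + (t ∸ q + q) * c k       ≡⟨ unshift (a k) (t ∸ q) q (c k) ⟩
      a k + (t ∸ q) * c k + q * c k ∎)
      where
      open ≡-Reasoning
      unshift : ∀ a s q c → a + (s + q) * c ≡ a + s * c + q * c
      unshift = solve-∀
      q≤t : q ≤ t
      q≤t = *-cancelʳ-≤ q t (c k) (+-cancelˡ-≤ (a k) _ _
              (≤-trans (+-monoˡ-≤ (q * c k) a≤n) (≤-reflexive eq)))

  FirstProgs : ℕ → ℕ → Set
  FirstProgs K n = ∃[ k ] (k < K × Prog a c k n)

  FirstProgs-periodic : ∀ K n → ∑[ k < K ] a k ≤ n → FirstProgs K n ⇔ FirstProgs K (n + ∏[ k < K ] c k)
  FirstProgs-periodic K n large = mk⇔
    (λ (k , k<K , p) → k , k<K , Equivalence.to (periodic k<K) p)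
    (λ (k , k<K , p) → k , k<K , Equivalence.from (periodic k<K) p)
    where
    periodic : ∀ {k} → k < K → Prog a c k n ⇔ Prog a c k (n + ∏[ k < K ] c k)
    periodic k<K = Prog-periodic (term∣∏< c k<K) (≤-trans (term≤∑< a k<K) large)

  Remainder : ℕ → ℕ → Set
  Remainder K n = UnionProg a c n × ¬ FirstProgs K n

  count-UnionProg : ∀ K N → count lem (UnionProg a c) N ≡ count lem (FirstProgs K) N + count lem (Remainder K) N
  count-UnionProg K = count-complement (λ n (k , _ , p) → k , p)

  count-Remainder≤ : ∀ K J N → (∀ i → J ≤ i → N < c (K + i)) →
    count lem (Remainder K) N
      ≤ count lem (RangeSet a) N + ∑[ i < J ] count lem (Progression⁺ (a (K + i)) (c (K + i))) N
  count-Remainder≤ K J N small = ≤-trans (count-⊎ N start-or-later) (+-monoʳ-≤ _ (count-∃< J N))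
    where
    start-or-later : ∀ n → n ≤ N → Remainder K n →
      RangeSet a n ⊎ ∃[ i ] (i < J × Progression⁺ (a (K + i)) (c (K + i)) n)
    start-or-later n n≤N ((k , t , n≡) , ¬first) with k <? K
    ... | yes k<K = ⊥-elim (¬first (k , k<K , t , n≡))
    ... | no k≮K with m≤n⇒∃[o]m+o≡n (≮⇒≥ k≮K) | t
    ...   | i , refl | zero   = inj₁ (K + i , sym (trans n≡ (+-identityʳ _)))
    ...   | i , refl | suc t′ with J ≤? i
    ...     | no J≰i = inj₂ (i , ≰⇒> J≰i , t′ , n≡)
    ...     | yes J≤i = ⊥-elim (<⇒≱ (small i J≤i) (begin
      c (K + i)                  ≤⟨ m≤m+n (c (K + i)) (t′ * c (K + i)) ⟩
      suc t′ * c (K + i)         ≤⟨ m≤n+m _ (a (K + i)) ⟩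
      a (K + i) + suc t′ * c (K + i) ≡⟨ sym n≡ ⟩
      n                          ≤⟨ n≤N ⟩
      N                          ∎))
      where open ≤-Reasoning

module Fractions where

  open import Data.Nat using (zero; suc; pred; _*_; z≤n; s≤s)
  import Data.Nat.Properties as ℕ
  open import Data.Integer as ℤ using (+_; +[1+_]; -[1+_])
  import Data.Integer.Properties as ℤ
  open import Data.Rational as ℚ using (ℚ; mkℚ; _/_; toℚᵘ; 0ℚ)
  import Data.Rational.Properties as ℚ
  open import Data.Rational.Unnormalised as ℚᵘ using (mkℚᵘ; *<*; *≤*)
  import Data.Rational.Unnormalised.Properties as ℚᵘ
  open import Data.Rational.Solver using (module +-*-Solver)
  open import Data.Nat.Tactic.RingSolver using (solve-∀)

  toℚᵘ-/ : ∀ n d .{{_ : NonZero d}} → toℚᵘ ((+ n) / d) ℚᵘ.≃ mkℚᵘ (+ n) (pred d)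
  toℚᵘ-/ n (suc d) = ℚ.toℚᵘ-fromℚᵘ (mkℚᵘ (+ n) d)

  /<⇒*< : ∀ a b c d .{{_ : NonZero b}} .{{_ : NonZero d}} → (+ a) / b ℚ.< (+ c) / d → a * d < c * b
  /<⇒*< a b@(suc _) c d@(suc _) a/b<c/d
    with ℚᵘ.<-respˡ-≃ (toℚᵘ-/ a b) (ℚᵘ.<-respʳ-≃ (toℚᵘ-/ c d) (ℚ.toℚᵘ-mono-< a/b<c/d))
  ... | *<* ad<cb = ℤ.drop‿+<+ (subst₂ ℤ._<_ (sym (ℤ.pos-* a d)) (sym (ℤ.pos-* c b)) ad<cb)

  /≤⇒*≤ : ∀ a b c d .{{_ : NonZero b}} .{{_ : NonZero d}} → (+ a) / b ℚ.≤ (+ c) / d → a * d ≤ c * b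
  /≤⇒*≤ a b@(suc _) c d@(suc _) a/b≤c/d
    with ℚᵘ.≤-respˡ-≃ (toℚᵘ-/ a b) (ℚᵘ.≤-respʳ-≃ (toℚᵘ-/ c d) (ℚ.toℚᵘ-mono-≤ a/b≤c/d))
  ... | *≤* ad≤cb = ℤ.drop‿+≤+ (subst₂ ℤ._≤_ (sym (ℤ.pos-* a d)) (sym (ℤ.pos-* c b)) ad≤cb)

  *<⇒/< : ∀ a b c d .{{_ : NonZero b}} .{{_ : NonZero d}} → a * d < c * b → (+ a) / b ℚ.< (+ c) / d
  *<⇒/< a b@(suc _) c d@(suc _) ad<cb = ℚ.toℚᵘ-cancel-<
    (ℚᵘ.<-respˡ-≃ (ℚᵘ.≃-sym (toℚᵘ-/ a b)) (ℚᵘ.<-respʳ-≃ (ℚᵘ.≃-sym (toℚᵘ-/ c d))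
      (*<* (subst₂ ℤ._<_ (ℤ.pos-* a d) (ℤ.pos-* c b) (ℤ.+<+ ad<cb)))))

  *≤⇒/≤ : ∀ a b c d .{{_ : NonZero b}} .{{_ : NonZero d}} → a * d ≤ c * b → (+ a) / b ℚ.≤ (+ c) / d
  *≤⇒/≤ a b@(suc _) c d@(suc _) ad≤cb = ℚ.toℚᵘ-cancel-≤
    (ℚᵘ.≤-respˡ-≃ (ℚᵘ.≃-sym (toℚᵘ-/ a b)) (ℚᵘ.≤-respʳ-≃ (ℚᵘ.≃-sym (toℚᵘ-/ c d))
      (*≤* (subst₂ ℤ._≤_ (ℤ.pos-* a d) (ℤ.pos-* c b) (ℤ.+≤+ ad≤cb)))))

  /+/ : ∀ a b-1 c d-1 → let b = suc b-1; d = suc d-1 in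
        (+ a) / b ℚ.+ (+ c) / d ≡ (+ (a * d + c * b)) / (b * d)
  /+/ a b-1 c d-1 = ℚ.toℚᵘ-injective (begin
    toℚᵘ ((+ a) / b ℚ.+ (+ c) / d)                ≈⟨ ℚ.toℚᵘ-homo-+ ((+ a) / b) ((+ c) / d) ⟩
    toℚᵘ ((+ a) / b) ℚᵘ.+ toℚᵘ ((+ c) / d)        ≈⟨ ℚᵘ.+-cong (toℚᵘ-/ a b) (toℚᵘ-/ c d) ⟩
    mkℚᵘ (+ a ℤ.* + d ℤ.+ + c ℤ.* + b) (pred (b * d)) ≡⟨ cong (λ n → mkℚᵘ n (pred (b * d))) numerator ⟩
    mkℚᵘ (+ (a * d + c * b)) (pred (b * d))       ≈⟨ ℚᵘ.≃-sym (toℚᵘ-/ (a * d + c * b) (b * d)) ⟩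
    toℚᵘ ((+ (a * d + c * b)) / (b * d))          ∎)
    where
    open ℚᵘ.≃-Reasoning
    b = suc b-1
    d = suc d-1
    numerator : + a ℤ.* + d ℤ.+ + c ℤ.* + b ≡ + (a * d + c * b)
    numerator = trans (cong₂ ℤ._+_ (sym (ℤ.pos-* a d)) (sym (ℤ.pos-* c b))) (sym (ℤ.pos-+ (a * d) (c * b)))

  /*/ : ∀ a b-1 c d-1 → let b = suc b-1; d = suc d-1 in
        ((+ a) / b) ℚ.* ((+ c) / d) ≡ (+ (a * c)) / (b * d)
  /*/ a b-1 c d-1 = ℚ.toℚᵘ-injective (begin
    toℚᵘ (((+ a) / b) ℚ.* ((+ c) / d))                ≈⟨ ℚ.toℚᵘ-homo-* ((+ a) / b) ((+ c) / d) ⟩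
    toℚᵘ ((+ a) / b) ℚᵘ.* toℚᵘ ((+ c) / d)        ≈⟨ ℚᵘ.*-cong (toℚᵘ-/ a b) (toℚᵘ-/ c d) ⟩
    mkℚᵘ (+ a ℤ.* + c) (pred (b * d))             ≡⟨ cong (λ n → mkℚᵘ n (pred (b * d))) (sym (ℤ.pos-* a c)) ⟩
    mkℚᵘ (+ (a * c)) (pred (b * d))               ≈⟨ ℚᵘ.≃-sym (toℚᵘ-/ (a * c) (b * d)) ⟩
    toℚᵘ ((+ (a * c)) / (b * d))                  ∎)
    where
    open ℚᵘ.≃-Reasoning
    b = suc b-1
    d = suc d-1

  0</ : ∀ d .{{_ : NonZero d}} → 0ℚ ℚ.< (+ 1) / d
  0</ d = *<⇒/< 0 1 1 d (s≤s z≤n)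

  0≤/ : ∀ n d .{{_ : NonZero d}} → 0ℚ ℚ.≤ (+ n) / d
  0≤/ n d = *≤⇒/≤ 0 1 n d z≤n

  0≤inv : ∀ n → 0ℚ ℚ.≤ inv n
  0≤inv zero    = ℚ.≤-refl
  0≤inv (suc n) = 0≤/ 1 (suc n)

  pos⇒1/suc≤ : ∀ ε → 0ℚ ℚ.< ε → ∃[ d ] ((+ 1) / suc d ℚ.≤ ε)
  pos⇒1/suc≤ ε@(mkℚ +[1+ n ] d _) _ = d , subst ((+ 1) / suc d ℚ.≤_) (ℚ.↥p/↧p≡p ε)
    (*≤⇒/≤ 1 (suc d) (suc n) (suc d) (ℕ.*-monoˡ-≤ (suc d) (s≤s (z≤n {n}))))
  pos⇒1/suc≤ (mkℚ (+ 0)    _ _) 0<0 with ℚ.positive 0<0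
  ... | ()
  pos⇒1/suc≤ (mkℚ -[1+ _ ] _ _) 0<ε with ℚ.positive 0<ε
  ... | ()

  fromℕ : ℕ → ℚ
  fromℕ n = (+ n) / 1

  fromℕ-+ : ∀ m n → fromℕ (m + n) ≡ fromℕ m ℚ.+ fromℕ n
  fromℕ-+ m n = sym (trans (/+/ m 0 n 0)
    (cong (λ k → (+ k) / 1) (cong₂ _+_ (ℕ.*-identityʳ m) (ℕ.*-identityʳ n))))

  fromℕ*1/ : ∀ n d → fromℕ n ℚ.* ((+ 1) / suc d) ≡ (+ n) / suc d
  fromℕ*1/ n d = trans (/*/ n 0 1 d) (cong₂ (λ a b → (+ a) / suc b) (ℕ.*-identityʳ n) (ℕ.+-identityʳ d))

  ≤fromℕ*inv : ∀ x c N → 0 < c → x * c ≤ N → fromℕ x ℚ.≤ fromℕ N ℚ.* inv c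
  ≤fromℕ*inv x (suc c-1) N _ xc≤N =
    subst (fromℕ x ℚ.≤_) (sym (fromℕ*1/ N c-1))
      (*≤⇒/≤ x 1 N (suc c-1) (subst (x * suc c-1 ≤_) (sym (ℕ.*-identityʳ N)) xc≤N))

  add-sub : ∀ p q → (p ℚ.+ q) ℚ.- p ≡ q
  add-sub = +-*-Solver.solve 2 (λ p q → (p :+ q) :- p := q) refl
    where open +-*-Solver

  neg-sub : ∀ p q → ℚ.- (p ℚ.- q) ≡ q ℚ.- p
  neg-sub = +-*-Solver.solve 2 (λ p q → :- (p :- q) := q :- p) refl
    where open +-*-Solver

  /-/<1/ : ∀ u m v n d → let M = suc m; N = suc n; D = suc d in
           D * u * N < D * v * M + M * N → (+ u) / M ℚ.- (+ v) / N ℚ.< (+ 1) / D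
  /-/<1/ u m v n d close = ℚ.<-respʳ-≡ (add-sub y δ) (ℚ.+-monoˡ-< (ℚ.- y) x<y+δ)
    where
    M = suc m
    N = suc n
    D = suc d
    y = (+ v) / N
    δ = (+ 1) / D
    lhs : ∀ D u N → D * u * N ≡ u * (N * D)
    lhs = solve-∀
    rhs : ∀ D v M N → D * v * M + M * N ≡ (v * D + 1 * N) * M
    rhs = solve-∀
    x<y+δ : (+ u) / M ℚ.< y ℚ.+ δ
    x<y+δ = subst ((+ u) / M ℚ.<_) (sym (/+/ v n 1 d))
      (*<⇒/< u M (v * D + 1 * N) (N * D) (subst₂ _<_ (lhs D u N) (rhs D v M N) close))

  ∣/-/∣<1/ : ∀ u m v n d → let M = suc m; N = suc n; D = suc d in
             D * u * N < D * v * M + M * N → D * v * M < D * u * N + N * M →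
             ℚ.∣ (+ u) / M ℚ.- (+ v) / N ∣ ℚ.< (+ 1) / D
  ∣/-/∣<1/ u m v n d close₁ close₂ with ℚ.∣p∣≡p∨∣p∣≡-p ((+ u) / suc m ℚ.- (+ v) / suc n)
  ... | inj₁ ∣p∣≡p  = subst (ℚ._< (+ 1) / suc d) (sym ∣p∣≡p) (/-/<1/ u m v n d close₁)
  ... | inj₂ ∣p∣≡-p = subst (ℚ._< (+ 1) / suc d)
    (sym (trans ∣p∣≡-p (neg-sub ((+ u) / suc m) ((+ v) / suc n)))) (/-/<1/ v n u m d close₂)

module SeriesAndDensityBounds where

  open import Data.Nat using (zero; suc; _*_)
  import Data.Nat.Properties as ℕ
  open import Data.Integer using (+_)
  open import Data.Rational as ℚ using (ℚ; _/_; 0ℚ)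
  import Data.Rational.Properties as ℚ
  open import Data.Rational.Solver using (module +-*-Solver)
  open Fractions

  density-zero⇒ : ∀ {lem P} → HasDensityZero lem P → ∀ D .{{_ : NonZero D}} →
                  ∃[ M ] (∀ n → M ≤ n → count lem P (suc n) * D < suc n)
  density-zero⇒ {lem} {P} dz D with dz ((+ 1) / D) (0</ D)
  ... | M , small = M , λ n M≤n → subst (count lem P (suc n) * D <_) (ℕ.*-identityˡ (suc n))
                                        (/<⇒*< (count lem P (suc n)) (suc n) 1 D (small n M≤n))

  terms-large : ∀ {c} → (∀ k → 0 < c k) → SeriesConverges c → ∀ N → ∃[ J ] (∀ k → J ≤ k → N < c k)
  terms-large {c} c>0 converges N with converges ((+ 1) / suc N) (0</ (suc N))
  ... | J , cauchy = J , λ k J≤k → inv<⇒< (c k) (c>0 k)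
    (subst (ℚ._< (+ 1) / suc N) (∣step∣ k) (cauchy (suc k) k (ℕ.m≤n⇒m≤1+n J≤k) J≤k))
    where
    ∣step∣ : ∀ k → ℚ.∣ partialSum c (suc k) ℚ.- partialSum c k ∣ ≡ inv (c k)
    ∣step∣ k = trans (cong ℚ.∣_∣ (add-sub (partialSum c k) (inv (c k)))) (ℚ.0≤p⇒∣p∣≡p (0≤inv (c k)))
    inv<⇒< : ∀ m → 0 < m → inv m ℚ.< (+ 1) / suc N → N < m
    inv<⇒< (suc m) _ 1/m<1/N = ℕ.m<n⇒m<1+n (ℕ.≤-pred
      (subst₂ _<_ (ℕ.*-identityˡ (suc N)) (ℕ.*-identityˡ (suc m)) (/<⇒*< 1 (suc m) 1 (suc N) 1/m<1/N)))

  tail-sums-small : ∀ {c} → (∀ k → 0 < c k) → SeriesConverges c → ∀ D .{{_ : NonZero D}} →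
    ∃[ K ] (∀ m N (x : ℕ → ℕ) → (∀ i → x i * c (K + i) ≤ N) → D * ∑[ i < m ] x i ≤ N)
  tail-sums-small {c} c>0 converges D@(suc d) with converges ((+ 1) / D) (0</ D)
  ... | K , cauchy = K , bound
    where
    tail : ℕ → ℚ
    tail m = partialSum c (K + m) ℚ.- partialSum c K

    tail-zero : tail 0 ≡ 0ℚ
    tail-zero rewrite ℕ.+-identityʳ K = ℚ.+-inverseʳ (partialSum c K)

    tail-suc : ∀ m → tail (suc m) ≡ tail m ℚ.+ inv (c (K + m))
    tail-suc m rewrite ℕ.+-suc K m = reorder (partialSum c (K + m)) (inv (c (K + m))) (partialSum c K)
      where
      reorder : ∀ s i t → (s ℚ.+ i) ℚ.- t ≡ (s ℚ.- t) ℚ.+ i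
      reorder = +-*-Solver.solve 3 (λ s i t → (s :+ i) :- t := (s :- t) :+ i) refl
        where open +-*-Solver

    0≤tail : ∀ m → 0ℚ ℚ.≤ tail m
    0≤tail zero    = ℚ.≤-reflexive (sym tail-zero)
    0≤tail (suc m) = subst (0ℚ ℚ.≤_) (sym (tail-suc m)) (ℚ.+-mono-≤ (0≤tail m) (0≤inv (c (K + m))))

    tail≤ : ∀ m → tail m ℚ.≤ (+ 1) / D
    tail≤ m = ℚ.<⇒≤ (subst (ℚ._< (+ 1) / D) (ℚ.0≤p⇒∣p∣≡p (0≤tail m))
                (cauchy (K + m) K (ℕ.m≤m+n K m) ℕ.≤-refl))

    ∑≤N*tail : ∀ N (x : ℕ → ℕ) → (∀ i → x i * c (K + i) ≤ N) →
               ∀ m → fromℕ (∑[ i < m ] x i) ℚ.≤ fromℕ N ℚ.* tail m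
    ∑≤N*tail N x small zero = ℚ.≤-reflexive (sym (trans (cong (fromℕ N ℚ.*_) tail-zero) (ℚ.*-zeroʳ (fromℕ N))))
    ∑≤N*tail N x small (suc m) = begin
      fromℕ (∑[ i < m ] x i + x m)                        ≡⟨ fromℕ-+ (∑[ i < m ] x i) (x m) ⟩
      fromℕ (∑[ i < m ] x i) ℚ.+ fromℕ (x m)              ≤⟨ ℚ.+-mono-≤ (∑≤N*tail N x small m)
                                                               (≤fromℕ*inv (x m) _ N (c>0 (K + m)) (small m)) ⟩
      fromℕ N ℚ.* tail m ℚ.+ fromℕ N ℚ.* inv (c (K + m))  ≡⟨ sym (ℚ.*-distribˡ-+ (fromℕ N) (tail m) _) ⟩
      fromℕ N ℚ.* (tail m ℚ.+ inv (c (K + m)))            ≡⟨ cong (fromℕ N ℚ.*_) (sym (tail-suc m)) ⟩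
      fromℕ N ℚ.* tail (suc m)                            ∎
      where open ℚ.≤-Reasoning

    bound : ∀ m N (x : ℕ → ℕ) → (∀ i → x i * c (K + i) ≤ N) → D * ∑[ i < m ] x i ≤ N
    bound m N x small = subst₂ _≤_ (ℕ.*-comm (∑[ i < m ] x i) D) (ℕ.*-identityʳ N)
      (/≤⇒*≤ (∑[ i < m ] x i) 1 N D (begin
        fromℕ (∑[ i < m ] x i)      ≤⟨ ∑≤N*tail N x small m ⟩
        fromℕ N ℚ.* tail m          ≤⟨ ℚ.*-monoˡ-≤-nonNeg (fromℕ N) {{ℚ.nonNegative (0≤/ N 1)}} (tail≤ m) ⟩
        fromℕ N ℚ.* ((+ 1) / D)     ≡⟨ fromℕ*1/ N d ⟩
        (+ N) / D                   ∎))
      where open ℚ.≤-Reasoning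

module CrossMultiplication where

  open import Data.Nat
  open import Data.Nat.Properties
  open import Data.Nat.Tactic.RingSolver using (solve-∀)

  cross-scaled : ∀ L C D x y M N → 0 < L → L * x * N ≤ L * y * M + C * (M + N) →
                 4 * D * C < M → 4 * D * C < N → 8 * D * x * N < 8 * D * y * M + 4 * (M * N)
  cross-scaled L C D x y M N 0<L cross C<M C<N = *-cancelˡ-< L _ _ (begin-strict
    L * (8 * D * x * N)                              ≡⟨ e₁ L D x N ⟩
    8 * D * (L * x * N)                              ≤⟨ *-monoʳ-≤ (8 * D) cross ⟩
    8 * D * (L * y * M + C * (M + N))                ≡⟨ e₂ L C D y M N ⟩
    L * (8 * D * y * M) + 2 * (4 * D * C * M + 4 * D * C * N)
      <⟨ +-monoʳ-< (L * (8 * D * y * M)) (*-monoʳ-< 2 (+-mono-< (*-monoˡ-< M C<N) (*-monoˡ-< N C<M))) ⟩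
    L * (8 * D * y * M) + 2 * (N * M + M * N)       ≡⟨ cong (L * (8 * D * y * M) +_) (e₃ M N) ⟩
    L * (8 * D * y * M) + 4 * (M * N)               ≤⟨ +-monoʳ-≤ (L * (8 * D * y * M)) (m≤n*m (4 * (M * N)) L) ⟩
    L * (8 * D * y * M) + L * (4 * (M * N))         ≡⟨ sym (*-distribˡ-+ L _ _) ⟩
    L * (8 * D * y * M + 4 * (M * N))               ∎)
    where
    open ≤-Reasoning
    instance
      _ = >-nonZero 0<L
      _ = >-nonZero (≤-<-trans z≤n C<M)
      _ = >-nonZero (≤-<-trans z≤n C<N)
    e₁ : ∀ L D x N → L * (8 * D * x * N) ≡ 8 * D * (L * x * N)
    e₁ = solve-∀
    e₂ : ∀ L C D y M N → 8 * D * (L * y * M + C * (M + N))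
                         ≡ L * (8 * D * y * M) + 2 * (4 * D * C * M + 4 * D * C * N)
    e₂ = solve-∀
    e₃ : ∀ M N → 2 * (N * M + M * N) ≡ 4 * (M * N)
    e₃ = solve-∀

  absorb-error : ∀ D x y e f M N → 8 * D * x * N < 8 * D * y * M + 4 * (M * N) → 8 * D * e < 2 * M →
                 D * (x + e) * N < D * (y + f) * M + M * N
  absorb-error D x y e f M N close e<M = *-cancelˡ-< 8 _ _ (begin-strict
    8 * (D * (x + e) * N)                                   ≡⟨ e₁ D x e N ⟩
    8 * D * x * N + 8 * D * e * N                           <⟨ +-mono-<-≤ close (*-monoˡ-≤ N (<⇒≤ e<M)) ⟩
    8 * D * y * M + 4 * (M * N) + 2 * M * N                 ≤⟨ +-mono-≤ (+-monoˡ-≤ _ y≤y+f) 2MN≤4MN ⟩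
    8 * D * (y + f) * M + 4 * (M * N) + 4 * (M * N)         ≡⟨ e₂ D y f M N ⟩
    8 * (D * (y + f) * M + M * N)                           ∎)
    where
    open ≤-Reasoning
    y≤y+f : 8 * D * y * M ≤ 8 * D * (y + f) * M
    y≤y+f = *-monoˡ-≤ M (*-monoʳ-≤ (8 * D) (m≤m+n y f))
    2MN≤4MN : 2 * M * N ≤ 4 * (M * N)
    2MN≤4MN = ≤-trans (≤-reflexive (*-assoc 2 M N)) (*-monoˡ-≤ (M * N) (s≤s (s≤s (z≤n {2}))))
    e₁ : ∀ D x e N → 8 * (D * (x + e) * N) ≡ 8 * D * x * N + 8 * D * e * N
    e₁ = solve-∀
    e₂ : ∀ D y f M N → 8 * D * (y + f) * M + 4 * (M * N) + 4 * (M * N) ≡ 8 * (D * (y + f) * M + M * N)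
    e₂ = solve-∀

module DensityOfUnion (lem : LEM) (a c : ℕ → ℕ) (c>0 : ∀ k → 0 < c k)
  (converges : SeriesConverges c) (sparse : HasDensityZero lem (RangeSet a)) (d : ℕ) where

  open import Data.Nat
  open import Data.Nat.Properties
  open Counting lem
  open UnionOfProgressions lem a c c>0
  open CrossMultiplication
  import Data.Integer as ℤ
  import Data.Rational as ℚ
  open Fractions using (∣/-/∣<1/)
  open SeriesAndDensityBounds

  D : ℕ
  D = suc d

  K : ℕ
  K = proj₁ (tail-sums-small c>0 converges (8 * D))

  rare-A : ∃[ M ] (∀ n → M ≤ n → count lem (RangeSet a) (suc n) * (8 * D) < suc n)
  rare-A = density-zero⇒ {lem} {RangeSet a} sparse (8 * D)

  instance
    period≢0 : NonZero (∏[ k < K ] c k)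
    period≢0 = >-nonZero (∏<-pos c>0 K)

  open EventuallyPeriodicCount lem (FirstProgs K) (∑[ k < K ] a k) (∏[ k < K ] c k) (FirstProgs-periodic K)

  count-Remainder< : ∀ n → proj₁ rare-A ≤ n → 8 * D * count lem (Remainder K) (suc n) < 2 * suc n
  count-Remainder< n M≤n = begin-strict
    8 * D * count lem (Remainder K) N
      ≤⟨ *-monoʳ-≤ (8 * D) (count-Remainder≤ K J N large) ⟩
    8 * D * (count lem (RangeSet a) N + ∑[ i < J ] tail i)
      ≡⟨ *-distribˡ-+ (8 * D) (count lem (RangeSet a) N) _ ⟩
    8 * D * count lem (RangeSet a) N + 8 * D * ∑[ i < J ] tail i
      <⟨ +-mono-<-≤ sparse-bound tail-bound ⟩
    N + N
      ≡⟨ cong (N +_) (sym (+-identityʳ N)) ⟩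
    2 * N ∎
    where
    open ≤-Reasoning
    N = suc n
    J = proj₁ (terms-large c>0 converges N)
    large : ∀ i → J ≤ i → N < c (K + i)
    large i J≤i = proj₂ (terms-large c>0 converges N) (K + i) (≤-trans J≤i (m≤n+m i K))
    tail : ℕ → ℕ
    tail i = count lem (Progression⁺ (a (K + i)) (c (K + i))) N
    sparse-bound : 8 * D * count lem (RangeSet a) N < N
    sparse-bound = subst (_< N) (*-comm (count lem (RangeSet a) N) (8 * D))
                     (proj₂ rare-A n M≤n)
    tail-bound : 8 * D * ∑[ i < J ] tail i ≤ N
    tail-bound = proj₂ (tail-sums-small c>0 converges (8 * D)) J N tail
                   (λ i → count-Progression⁺ (a (K + i)) (c (K + i)) N)

  M₀ : ℕ
  M₀ = proj₁ rare-A + 4 * D * slack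

  counts-close : ∀ m n → M₀ ≤ m → M₀ ≤ n →
    D * count lem (UnionProg a c) (suc m) * suc n < D * count lem (UnionProg a c) (suc n) * suc m + suc m * suc n
  counts-close m n M₀≤m M₀≤n =
    subst₂ (λ x y → D * x * suc n < D * y * suc m + suc m * suc n)
      (sym (count-UnionProg K (suc m))) (sym (count-UnionProg K (suc n)))
      (absorb-error D (periodic m) (periodic n) (remainder m) (remainder n) (suc m) (suc n)
        (cross-scaled (∏[ k < K ] c k) slack D (periodic m) (periodic n) (suc m) (suc n) (∏<-pos c>0 K)
          (count-cross (suc m) (suc n)) (slack< M₀≤m) (slack< M₀≤n))
        (count-Remainder< m (≤-trans (m≤m+n _ _) M₀≤m)))
    where
    periodic remainder : ℕ → ℕ
    periodic k = count lem (FirstProgs K) (suc k)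
    remainder k = count lem (Remainder K) (suc k)
    slack< : ∀ {k} → M₀ ≤ k → 4 * D * slack < suc k
    slack< M₀≤k = s≤s (≤-trans (m≤n+m (4 * D * slack) (proj₁ rare-A)) M₀≤k)

  ratios-close : ∀ m n → M₀ ≤ m → M₀ ≤ n →
    ℚ.∣ ratio lem (UnionProg a c) m ℚ.- ratio lem (UnionProg a c) n ∣ ℚ.< (ℤ.+ 1) ℚ./ D
  ratios-close m n M₀≤m M₀≤n =
    ∣/-/∣<1/ (count lem (UnionProg a c) (suc m)) m (count lem (UnionProg a c) (suc n)) n d
      (counts-close m n M₀≤m M₀≤n) (counts-close n m M₀≤n M₀≤m)

lemma5 : (lem : LEM) (a c : ℕ → ℕ)
    → ((k : ℕ) → 0 < a k) → ((k : ℕ) → 0 < c k)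
    → SeriesConverges c
    → HasDensityZero lem (RangeSet a)
    → HasDensity lem (UnionProg a c)
lemma5 lem a c _ c>0 converges sparse ε 0<ε with Fractions.pos⇒1/suc≤ ε 0<ε
... | d , 1/D≤ε = M₀ , λ m n M₀≤m M₀≤n → ℚ.<-≤-trans (ratios-close m n M₀≤m M₀≤n) 1/D≤ε
  where open DensityOfUnion lem a c c>0 converges sparse d
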